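{- If there exist a $3$-way $d$-homogeneous $(v_1,3,2)$ Steiner trade of volume $m_1$ and a $3$-way $d$-homogeneous $(v_2,3,2)$ Steiner trade of volume $m_2$, then there exists a $3$-way $d$-homogeneous $(v_1+v_2,3,2)$ Steiner trade of volume $m_1+m_2$.
   Context: Let $V$ be a finite set with $v$ elements and let $t<k<v$ be positive integers. A $\mu$-way $(v,k,t)$ trade $T=\{T_1,\dots,T_\mu\}$ of volume $m$ consists of $\mu$ pairwise disjoint collections $T_1,\dots,T_\mu$, each consisting of $m$ blocks (a block is a $k$-subset of $V$), such that for every $t$-subset of $V$ the number of blocks containing it is the same in each $T_i$. All the $T_i$ cover the same set of elements, called the foundation $\mathrm{found}(T)$. The trade is a Steiner trade if every $t$-subset of $\mathrm{found}(T)$ is contained in at most one block of each $T_i$. It is $d$-homogeneous if every element of $V$ lies in exactly $d$ blocks of each $T_i$. -}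

module Defs where

open import Data.Nat using (ℕ; zero; suc; _≤_; _<_)
open import Data.Fin using (Fin)
open import Data.Fin.Subset using (Subset; _⊆_; _∈_; ∣_∣; ⋃; ⁅_⁆)
open import Data.Fin.Subset.Properties using (_⊆?_)
open import Data.Vec using (Vec; []; _∷_; toList)
open import Data.Vec.Membership.Propositional renaming (_∈_ to _∈ᵥ_)
open import Data.Product using (_×_)
open import Relation.Nullary using (¬_; yes; no)
open import Relation.Binary.PropositionalEquality using (_≡_; _≢_)
open import Function.Definitions using (Injective)
open import Data.Vec using (lookup)

-- The ground set V is Fin v; a block is a subset of Fin v (of size k).
-- A collection of m blocks is a Vec of m subsets.

countContaining : ∀ {v m} → Subset v → Vec (Subset v) m → ℕ
countContaining S []      = zero
countContaining S (B ∷ Bs) with S ⊆? B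
... | yes _ = suc (countContaining S Bs)
... | no  _ = countContaining S Bs

cover : ∀ {v m} → Vec (Subset v) m → Subset v
cover Bs = ⋃ (toList Bs)

-- A μ-way (v,k,t) trade of volume m: T i is the i-th collection.
record IsTrade (μ v k t m : ℕ) (T : Fin μ → Vec (Subset v) m) : Set where
  field
    t<k        : t < k
    k<v        : k < v
    blockSize  : ∀ i (B : Subset v) → B ∈ᵥ T i → ∣ B ∣ ≡ k
    distinct   : ∀ i → Injective _≡_ _≡_ (lookup (T i))
    disjoint   : ∀ i j → i ≢ j → ∀ (B : Subset v) → B ∈ᵥ T i → ¬ (B ∈ᵥ T j)
    balanced   : ∀ (S : Subset v) → ∣ S ∣ ≡ t → ∀ i j →
                 countContaining S (T i) ≡ countContaining S (T j)
    sameFound  : ∀ i j → cover (T i) ≡ cover (T j)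

-- foundation of a μ-way trade with μ ≥ 1 (cover of T 0; all covers agree)
found : ∀ {μ v m} → (Fin (suc μ) → Vec (Subset v) m) → Subset v
found T = cover (T Fin.zero)
  where import Data.Fin as Fin

IsSteiner : ∀ {μ v m} (t : ℕ) → (Fin (suc μ) → Vec (Subset v) m) → Set
IsSteiner {v = v} t T =
  ∀ (S : Subset v) → ∣ S ∣ ≡ t → S ⊆ found T → ∀ i → countContaining S (T i) ≤ 1

IsHomogeneous : ∀ {μ v m} (d : ℕ) → (Fin μ → Vec (Subset v) m) → Set
IsHomogeneous {v = v} d T = ∀ (x : Fin v) i → countContaining ⁅ x ⁆ (T i) ≡ d

SteinerTrade3 : (d v m : ℕ) → Set
SteinerTrade3 d v m =
  Σ (Fin 3 → Vec (Subset v) m) λ T →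
    IsTrade 3 v 3 2 m T × IsSteiner 2 T × IsHomogeneous d T
  where open import Data.Product using (Σ)

-- Place the two trades side by side on disjoint ground sets: the i-th collection of the new
-- trade is the union of the i-th collections of the two old ones.  A t-subset lying inside one
-- ground set is counted exactly as in the corresponding old trade, while a t-subset meeting
-- both ground sets lies in no block at all, so balance, the Steiner property and homogeneity
-- all survive; the volumes and the sizes of the ground sets add up.
module Submission where

open import Defs
open import Data.Bool using (true; false)
open import Data.Empty using (⊥-elim)
open import Data.Fin using (Fin; _↑ˡ_; _↑ʳ_)
import Data.Fin as Fin
open import Data.Fin.Subset using (Subset; _⊆_; _∈_; ∣_∣; ⁅_⁆; ⊥; _∪_; Nonempty)
open import Data.Fin.Subset.Properties
  using (_⊆?_; ⊆-refl; ⊆-min; drop-∷-⊆; ∉⊥; x∈⁅x⁆; ∣⊥∣≡0; nonempty?; Empty-unique;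
         ∪-assoc; ∪-identityˡ; ∪-identityʳ)
open import Data.Nat using (ℕ; zero; suc; _+_; _≤_; _<_; z≤n)
open import Data.Nat.Properties using (+-identityʳ; ≤-trans; ≤-<-trans; m≤m+n; 0≢1+n)
open import Data.Product using (∃; _×_; _,_)
open import Data.Sum as Sum using (_⊎_; inj₁; inj₂)
open import Data.Vec using (Vec; []; _∷_; _++_; map; lookup; splitAt; here; there)
open import Data.Vec.Properties using (lookup-map; lookup-++ˡ; lookup-++ʳ; ++-injectiveˡ; ++-injectiveʳ)
open import Data.Vec.Membership.Propositional using (find) renaming (_∈_ to _∈ᵥ_)
open import Data.Vec.Membership.Propositional.Properties using (∈-lookup)
import Data.Vec.Relation.Unary.Any.Properties as Any
open import Function.Base using (_∘_)
open import Function.Bundles using (_⇔_; mk⇔; Equivalence)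
open import Function.Definitions using (Injective)
open import Relation.Nullary using (¬_; yes; no)
open import Relation.Binary.PropositionalEquality

private
  variable
    d k l m n t μ v₁ v₂ m₁ m₂ : ℕ

⊆-++⁺ : {a b : Subset m} {c d : Subset n} → a ⊆ b → c ⊆ d → (a ++ c) ⊆ (b ++ d)
⊆-++⁺ {a = []}    {[]}    _ c⊆d x∈ = c⊆d x∈
⊆-++⁺ {a = _ ∷ _} {_ ∷ _} a⊆b _ here with a⊆b here
... | here = here
⊆-++⁺ {a = _ ∷ _} {_ ∷ _} a⊆b c⊆d (there x∈) = there (⊆-++⁺ (drop-∷-⊆ a⊆b) c⊆d x∈)

⊆-++⁻ˡ : {a b : Subset m} {c d : Subset n} → (a ++ c) ⊆ (b ++ d) → a ⊆ b
⊆-++⁻ˡ {a = _ ∷ _} {_ ∷ _} h here with h here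
... | here = here
⊆-++⁻ˡ {a = _ ∷ _} {_ ∷ _} h (there x∈) = there (⊆-++⁻ˡ (drop-∷-⊆ h) x∈)

⊆-++⁻ʳ : {a b : Subset m} {c d : Subset n} → (a ++ c) ⊆ (b ++ d) → c ⊆ d
⊆-++⁻ʳ {a = []}    {[]}    h = h
⊆-++⁻ʳ {a = _ ∷ a} {_ ∷ b} h = ⊆-++⁻ʳ {a = a} {b} (drop-∷-⊆ h)

∣p++q∣≡∣p∣+∣q∣ : (p : Subset m) (q : Subset n) → ∣ p ++ q ∣ ≡ ∣ p ∣ + ∣ q ∣
∣p++q∣≡∣p∣+∣q∣ []          q = refl
∣p++q∣≡∣p∣+∣q∣ (true ∷ p)  q = cong suc (∣p++q∣≡∣p∣+∣q∣ p q)
∣p++q∣≡∣p∣+∣q∣ (false ∷ p) q = ∣p++q∣≡∣p∣+∣q∣ p q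

∣p++⊥∣≡∣p∣ : ∀ n (p : Subset m) → ∣ p ++ ⊥ {n} ∣ ≡ ∣ p ∣
∣p++⊥∣≡∣p∣ n p = trans (∣p++q∣≡∣p∣+∣q∣ p ⊥) (trans (cong (∣ p ∣ +_) (∣⊥∣≡0 n)) (+-identityʳ _))

∣⊥++q∣≡∣q∣ : ∀ m (q : Subset n) → ∣ ⊥ {m} ++ q ∣ ≡ ∣ q ∣
∣⊥++q∣≡∣q∣ m q = trans (∣p++q∣≡∣p∣+∣q∣ (⊥ {m}) q) (cong (_+ ∣ q ∣) (∣⊥∣≡0 m))

⊥++⊥ : ⊥ {m} ++ ⊥ {n} ≡ ⊥
⊥++⊥ {zero}  = refl
⊥++⊥ {suc m} {n} = cong (false ∷_) (⊥++⊥ {m} {n})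

∪-++ : (a b : Subset m) (c d : Subset n) → (a ++ c) ∪ (b ++ d) ≡ (a ∪ b) ++ (c ∪ d)
∪-++ []      []      c d = refl
∪-++ (_ ∷ a) (_ ∷ b) c d = cong (_ ∷_) (∪-++ a b c d)

⁅↑ˡ⁆ : (i : Fin m) → ⁅ i ↑ˡ n ⁆ ≡ ⁅ i ⁆ ++ ⊥
⁅↑ˡ⁆ {suc m} {n} Fin.zero = cong (true ∷_) (sym (⊥++⊥ {m} {n}))
⁅↑ˡ⁆ (Fin.suc i)         = cong (false ∷_) (⁅↑ˡ⁆ i)

⁅↑ʳ⁆ : ∀ m (j : Fin n) → ⁅ m ↑ʳ j ⁆ ≡ ⊥ ++ ⁅ j ⁆
⁅↑ʳ⁆ zero    j = refl
⁅↑ʳ⁆ (suc m) j = cong (false ∷_) (⁅↑ʳ⁆ m j)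

Nonempty⇒⊈⊥ : {p : Subset n} → Nonempty p → ¬ p ⊆ ⊥
Nonempty⇒⊈⊥ (_ , x∈p) p⊆⊥ = ∉⊥ (p⊆⊥ x∈p)

0<∣p∣⇒Nonempty : (p : Subset n) → 0 < ∣ p ∣ → Nonempty p
0<∣p∣⇒Nonempty (true ∷ p)  _ = Fin.zero , here
0<∣p∣⇒Nonempty (false ∷ p) h with 0<∣p∣⇒Nonempty p h
... | x , x∈p = Fin.suc x , there x∈p

p++⊥≢⊥++q : {p : Subset m} {q : Subset n} → Nonempty p → p ++ ⊥ ≢ ⊥ ++ q
p++⊥≢⊥++q {p = p} ne eq = Nonempty⇒⊈⊥ ne (λ x∈p → subst (_ ∈_) (++-injectiveˡ p ⊥ eq) x∈p)

data SubsetView {m n : ℕ} : Subset (m + n) → Set where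
  empty : SubsetView ⊥
  left  : {p : Subset m} → Nonempty p → SubsetView (p ++ ⊥)
  right : {q : Subset n} → Nonempty q → SubsetView (⊥ ++ q)
  both  : {p : Subset m} {q : Subset n} → Nonempty p → Nonempty q → SubsetView (p ++ q)

subsetView : (s : Subset (m + n)) → SubsetView s
subsetView {m} {n} s with splitAt m s
... | p , q , refl with nonempty? p | nonempty? q
...   | yes ne-p | yes ne-q = both ne-p ne-q
...   | yes ne-p | no  e-q  rewrite Empty-unique e-q = left ne-p
...   | no  e-p  | yes ne-q rewrite Empty-unique e-p = right ne-q
...   | no  e-p  | no  e-q  rewrite Empty-unique e-p | Empty-unique e-q = subst SubsetView (sym (⊥++⊥ {m} {n})) empty

countContaining-++ : (S : Subset n) (xs : Vec (Subset n) k) (ys : Vec (Subset n) l) →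
  countContaining S (xs ++ ys) ≡ countContaining S xs + countContaining S ys
countContaining-++ S []       ys = refl
countContaining-++ S (B ∷ xs) ys with S ⊆? B
... | yes _ = cong suc (countContaining-++ S xs ys)
... | no  _ = countContaining-++ S xs ys

countContaining-⊥ : (xs : Vec (Subset n) k) → countContaining ⊥ xs ≡ k
countContaining-⊥ []       = refl
countContaining-⊥ (B ∷ xs) with ⊥ ⊆? B
... | yes _   = cong suc (countContaining-⊥ xs)
... | no  ⊥⊈B = ⊥-elim (⊥⊈B (⊆-min B))

countContaining-map : (f : Subset m → Subset n) {S : Subset n} {S′ : Subset m} →
  (∀ B → S ⊆ f B ⇔ S′ ⊆ B) →
  (xs : Vec (Subset m) k) → countContaining S (map f xs) ≡ countContaining S′ xs
countContaining-map f {S} {S′} S⊆f⇔S′⊆ []       = refl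
countContaining-map f {S} {S′} S⊆f⇔S′⊆ (B ∷ xs) with S ⊆? f B | S′ ⊆? B
... | yes _   | yes _    = cong suc (countContaining-map f S⊆f⇔S′⊆ xs)
... | no  _   | no  _    = countContaining-map f S⊆f⇔S′⊆ xs
... | yes S⊆  | no  S′⊈  = ⊥-elim (S′⊈ (Equivalence.to (S⊆f⇔S′⊆ B) S⊆))
... | no  S⊈  | yes S′⊆  = ⊥-elim (S⊈ (Equivalence.from (S⊆f⇔S′⊆ B) S′⊆))

countContaining-map-⊈ : (f : Subset m → Subset n) {S : Subset n} → (∀ B → ¬ S ⊆ f B) →
  (xs : Vec (Subset m) k) → countContaining S (map f xs) ≡ 0
countContaining-map-⊈ f S⊈f []       = refl
countContaining-map-⊈ f {S} S⊈f (B ∷ xs) with S ⊆? f B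
... | yes S⊆ = ⊥-elim (S⊈f B S⊆)
... | no  _  = countContaining-map-⊈ f S⊈f xs

countContaining-map-++ʳ : {a : Subset m} {c d : Subset n} → c ⊆ d → (xs : Vec (Subset m) k) →
  countContaining (a ++ c) (map (_++ d) xs) ≡ countContaining a xs
countContaining-map-++ʳ {c = c} {d} c⊆d =
  countContaining-map (_++ d) (λ B → mk⇔ (⊆-++⁻ˡ {c = c} {d}) (λ a⊆B → ⊆-++⁺ a⊆B c⊆d))

countContaining-map-++ʳ-⊈ : {a : Subset m} {c d : Subset n} → ¬ c ⊆ d → (xs : Vec (Subset m) k) →
  countContaining (a ++ c) (map (_++ d) xs) ≡ 0
countContaining-map-++ʳ-⊈ {a = a} {d = d} c⊈d =
  countContaining-map-⊈ (_++ d) (λ B h → c⊈d (⊆-++⁻ʳ {a = a} {B} h))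

countContaining-map-++ˡ : {a b : Subset m} {c : Subset n} → a ⊆ b → (xs : Vec (Subset n) k) →
  countContaining (a ++ c) (map (b ++_) xs) ≡ countContaining c xs
countContaining-map-++ˡ {a = a} {b} a⊆b =
  countContaining-map (b ++_) (λ B → mk⇔ (⊆-++⁻ʳ {a = a} {b}) (⊆-++⁺ a⊆b))

countContaining-map-++ˡ-⊈ : {a b : Subset m} {c : Subset n} → ¬ a ⊆ b → (xs : Vec (Subset n) k) →
  countContaining (a ++ c) (map (b ++_) xs) ≡ 0
countContaining-map-++ˡ-⊈ {b = b} {c} a⊈b =
  countContaining-map-⊈ (b ++_) (λ B h → a⊈b (⊆-++⁻ˡ {c = c} {B} h))

data FinView (m n : ℕ) : Fin (m + n) → Set where
  inl : (i : Fin m) → FinView m n (i ↑ˡ n)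
  inr : (j : Fin n) → FinView m n (m ↑ʳ j)

finView : ∀ m n (x : Fin (m + n)) → FinView m n x
finView zero    n x           = inr x
finView (suc m) n Fin.zero    = inl Fin.zero
finView (suc m) n (Fin.suc x) with finView m n x
... | inl i = inl (Fin.suc i)
... | inr j = inr j

lookup-++-injective : {A : Set} (xs : Vec A k) (ys : Vec A l) →
  Injective _≡_ _≡_ (lookup xs) → Injective _≡_ _≡_ (lookup ys) →
  (∀ i j → lookup xs i ≢ lookup ys j) → Injective _≡_ _≡_ (lookup (xs ++ ys))
lookup-++-injective {k} {l} xs ys inj-xs inj-ys xs≢ys {x} {y} eq with finView k l x | finView k l y
... | inl i | inl i′ = cong (_↑ˡ l) (inj-xs (trans (sym (lookup-++ˡ xs ys i)) (trans eq (lookup-++ˡ xs ys i′))))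
... | inr j | inr j′ = cong (k ↑ʳ_) (inj-ys (trans (sym (lookup-++ʳ xs ys j)) (trans eq (lookup-++ʳ xs ys j′))))
... | inl i | inr j′ = ⊥-elim (xs≢ys i j′ (trans (sym (lookup-++ˡ xs ys i)) (trans eq (lookup-++ʳ xs ys j′))))
... | inr j | inl i′ = ⊥-elim (xs≢ys i′ j (trans (sym (lookup-++ˡ xs ys i′)) (trans (sym eq) (lookup-++ʳ xs ys j))))

lookup-map-injective : {A B : Set} (f : A → B) (xs : Vec A k) → (∀ {a b} → f a ≡ f b → a ≡ b) →
  Injective _≡_ _≡_ (lookup xs) → Injective _≡_ _≡_ (lookup (map f xs))
lookup-map-injective f xs inj-f inj-xs {i} {j} eq =
  inj-xs (inj-f (trans (sym (lookup-map i f xs)) (trans eq (lookup-map j f xs))))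

infixr 5 _⊕_
_⊕_ : Vec (Subset m) k → Vec (Subset n) l → Vec (Subset (m + n)) (k + l)
xs ⊕ ys = map (_++ ⊥) xs ++ map (⊥ ++_) ys

∈-⊕⁻ : {B : Subset (m + n)} (xs : Vec (Subset m) k) (ys : Vec (Subset n) l) → B ∈ᵥ xs ⊕ ys →
  (∃ λ a → a ∈ᵥ xs × B ≡ a ++ ⊥) ⊎ (∃ λ b → b ∈ᵥ ys × B ≡ ⊥ ++ b)
∈-⊕⁻ xs ys B∈ = Sum.map (find ∘ Any.map⁻) (find ∘ Any.map⁻) (Any.++⁻ (map (_++ ⊥) xs) B∈)

lookup-⊕-injective : (xs : Vec (Subset m) k) (ys : Vec (Subset n) l) → (∀ a → a ∈ᵥ xs → Nonempty a) →
  Injective _≡_ _≡_ (lookup xs) → Injective _≡_ _≡_ (lookup ys) → Injective _≡_ _≡_ (lookup (xs ⊕ ys))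
lookup-⊕-injective xs ys ne-xs inj-xs inj-ys =
  lookup-++-injective (map (_++ ⊥) xs) (map (⊥ ++_) ys)
    (lookup-map-injective (_++ ⊥) xs (++-injectiveˡ _ _) inj-xs)
    (lookup-map-injective (⊥ ++_) ys (++-injectiveʳ ⊥ ⊥) inj-ys)
    λ i j eq → p++⊥≢⊥++q (ne-xs _ (∈-lookup i xs))
                 (trans (sym (lookup-map i (_++ ⊥) xs)) (trans eq (lookup-map j (⊥ ++_) ys)))

countContaining-⊕ˡ : {p : Subset m} → Nonempty p → (xs : Vec (Subset m) k) (ys : Vec (Subset n) l) →
  countContaining (p ++ ⊥) (xs ⊕ ys) ≡ countContaining p xs
countContaining-⊕ˡ ne-p xs ys = trans (countContaining-++ _ (map (_++ ⊥) xs) _)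
  (trans (cong₂ _+_ (countContaining-map-++ʳ ⊆-refl xs) (countContaining-map-++ˡ-⊈ (Nonempty⇒⊈⊥ ne-p) ys))
         (+-identityʳ _))

countContaining-⊕ʳ : {q : Subset n} → Nonempty q → (xs : Vec (Subset m) k) (ys : Vec (Subset n) l) →
  countContaining (⊥ ++ q) (xs ⊕ ys) ≡ countContaining q ys
countContaining-⊕ʳ ne-q xs ys = trans (countContaining-++ _ (map (_++ ⊥) xs) _)
  (cong₂ _+_ (countContaining-map-++ʳ-⊈ (Nonempty⇒⊈⊥ ne-q) xs) (countContaining-map-++ˡ ⊆-refl ys))

countContaining-⊕-straddling : {p : Subset m} {q : Subset n} → Nonempty p → Nonempty q →
  (xs : Vec (Subset m) k) (ys : Vec (Subset n) l) → countContaining (p ++ q) (xs ⊕ ys) ≡ 0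
countContaining-⊕-straddling ne-p ne-q xs ys = trans (countContaining-++ _ (map (_++ ⊥) xs) _)
  (cong₂ _+_ (countContaining-map-++ʳ-⊈ (Nonempty⇒⊈⊥ ne-q) xs) (countContaining-map-++ˡ-⊈ (Nonempty⇒⊈⊥ ne-p) ys))

cover-++ : (xs : Vec (Subset n) k) (ys : Vec (Subset n) l) → cover (xs ++ ys) ≡ cover xs ∪ cover ys
cover-++ []       ys = sym (∪-identityˡ _)
cover-++ (x ∷ xs) ys = trans (cong (x ∪_) (cover-++ xs ys)) (sym (∪-assoc x _ _))

cover-map-++⊥ : (xs : Vec (Subset m) k) → cover (map (_++ ⊥ {n}) xs) ≡ cover xs ++ ⊥
cover-map-++⊥ {m} {n = n} []       = sym (⊥++⊥ {m} {n})
cover-map-++⊥ (x ∷ xs) = trans (cong ((x ++ ⊥) ∪_) (cover-map-++⊥ xs))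
  (trans (∪-++ x (cover xs) ⊥ ⊥) (cong ((x ∪ cover xs) ++_) (∪-identityˡ ⊥)))

cover-map-⊥++ : (ys : Vec (Subset n) l) → cover (map (⊥ {m} ++_) ys) ≡ ⊥ ++ cover ys
cover-map-⊥++ {m = m} []       = sym (⊥++⊥ {m})
cover-map-⊥++ {m = m} (y ∷ ys) = trans (cong ((⊥ ++ y) ∪_) (cover-map-⊥++ ys))
  (trans (∪-++ (⊥ {m}) ⊥ y (cover ys)) (cong (_++ (y ∪ cover ys)) (∪-identityˡ ⊥)))

cover-⊕ : (xs : Vec (Subset m) k) (ys : Vec (Subset n) l) → cover (xs ⊕ ys) ≡ cover xs ++ cover ys
cover-⊕ xs ys = begin
  cover (xs ⊕ ys)                            ≡⟨ cover-++ (map (_++ ⊥) xs) _ ⟩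
  cover (map (_++ ⊥) xs) ∪ cover (map (⊥ ++_) ys) ≡⟨ cong₂ _∪_ (cover-map-++⊥ xs) (cover-map-⊥++ ys) ⟩
  (cover xs ++ ⊥) ∪ (⊥ ++ cover ys)          ≡⟨ ∪-++ (cover xs) ⊥ ⊥ (cover ys) ⟩
  (cover xs ∪ ⊥) ++ (⊥ ∪ cover ys)           ≡⟨ cong₂ _++_ (∪-identityʳ (cover xs)) (∪-identityˡ (cover ys)) ⟩
  cover xs ++ cover ys                       ∎
  where open ≡-Reasoning

infixr 5 _⊕ᵗ_
_⊕ᵗ_ : (Fin μ → Vec (Subset m) k) → (Fin μ → Vec (Subset n) l) → Fin μ → Vec (Subset (m + n)) (k + l)
(T₁ ⊕ᵗ T₂) i = T₁ i ⊕ T₂ i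

⊕ᵗ-isTrade : {T₁ : Fin μ → Vec (Subset v₁) m₁} {T₂ : Fin μ → Vec (Subset v₂) m₂} →
  IsTrade μ v₁ k t m₁ T₁ → IsTrade μ v₂ k t m₂ T₂ → IsTrade μ (v₁ + v₂) k t (m₁ + m₂) (T₁ ⊕ᵗ T₂)
⊕ᵗ-isTrade {v₁ = v₁} {v₂ = v₂} {k = k} {t = t} {T₁ = T₁} {T₂} trade₁ trade₂ = record
  { t<k       = I₁.t<k
  ; k<v       = ≤-trans I₁.k<v (m≤m+n v₁ v₂)
  ; blockSize = blockSize
  ; distinct  = λ i → lookup-⊕-injective (T₁ i) (T₂ i) (block-nonempty i) (I₁.distinct i) (I₂.distinct i)
  ; disjoint  = disjoint
  ; balanced  = balanced
  ; sameFound = λ i j → trans (cover-⊕ (T₁ i) (T₂ i))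
      (trans (cong₂ _++_ (I₁.sameFound i j) (I₂.sameFound i j)) (sym (cover-⊕ (T₁ j) (T₂ j))))
  }
  where
  module I₁ = IsTrade trade₁
  module I₂ = IsTrade trade₂

  block-nonempty : ∀ i a → a ∈ᵥ T₁ i → Nonempty a
  block-nonempty i a a∈ = 0<∣p∣⇒Nonempty a (subst (0 <_) (sym (I₁.blockSize i a a∈)) (≤-<-trans z≤n I₁.t<k))

  blockSize : ∀ i (B : Subset (v₁ + v₂)) → B ∈ᵥ (T₁ ⊕ᵗ T₂) i → ∣ B ∣ ≡ k
  blockSize i B B∈ with ∈-⊕⁻ (T₁ i) (T₂ i) B∈
  ... | inj₁ (a , a∈ , refl) = trans (∣p++⊥∣≡∣p∣ v₂ a) (I₁.blockSize i a a∈)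
  ... | inj₂ (b , b∈ , refl) = trans (∣⊥++q∣≡∣q∣ v₁ b) (I₂.blockSize i b b∈)

  disjoint : ∀ i j → i ≢ j → ∀ (B : Subset (v₁ + v₂)) → B ∈ᵥ (T₁ ⊕ᵗ T₂) i → ¬ B ∈ᵥ (T₁ ⊕ᵗ T₂) j
  disjoint i j i≢j B B∈i B∈j with ∈-⊕⁻ (T₁ i) (T₂ i) B∈i | ∈-⊕⁻ (T₁ j) (T₂ j) B∈j
  ... | inj₁ (a , a∈ , refl) | inj₁ (a′ , a′∈ , eq) =
    I₁.disjoint i j i≢j a a∈ (subst (_∈ᵥ T₁ j) (sym (++-injectiveˡ a a′ eq)) a′∈)
  ... | inj₂ (b , b∈ , refl) | inj₂ (b′ , b′∈ , eq) =
    I₂.disjoint i j i≢j b b∈ (subst (_∈ᵥ T₂ j) (sym (++-injectiveʳ (⊥ {v₁}) ⊥ eq)) b′∈)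
  ... | inj₁ (a , a∈ , refl) | inj₂ (_ , _ , eq) = p++⊥≢⊥++q (block-nonempty i a a∈) eq
  ... | inj₂ (_ , _ , refl) | inj₁ (a , a∈ , eq) = p++⊥≢⊥++q (block-nonempty j a a∈) (sym eq)

  balanced : ∀ (S : Subset (v₁ + v₂)) → ∣ S ∣ ≡ t → ∀ i j →
             countContaining S ((T₁ ⊕ᵗ T₂) i) ≡ countContaining S ((T₁ ⊕ᵗ T₂) j)
  balanced S ∣S∣≡t i j with subsetView {v₁} {v₂} S
  ... | empty = trans (countContaining-⊥ ((T₁ ⊕ᵗ T₂) i)) (sym (countContaining-⊥ ((T₁ ⊕ᵗ T₂) j)))
  ... | left {p} ne-p = begin
    countContaining (p ++ ⊥) ((T₁ ⊕ᵗ T₂) i) ≡⟨ countContaining-⊕ˡ ne-p (T₁ i) (T₂ i) ⟩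
    countContaining p (T₁ i)               ≡⟨ I₁.balanced p (trans (sym (∣p++⊥∣≡∣p∣ v₂ p)) ∣S∣≡t) i j ⟩
    countContaining p (T₁ j)               ≡⟨ countContaining-⊕ˡ ne-p (T₁ j) (T₂ j) ⟨
    countContaining (p ++ ⊥) ((T₁ ⊕ᵗ T₂) j) ∎
    where open ≡-Reasoning
  ... | right {q} ne-q = begin
    countContaining (⊥ ++ q) ((T₁ ⊕ᵗ T₂) i) ≡⟨ countContaining-⊕ʳ ne-q (T₁ i) (T₂ i) ⟩
    countContaining q (T₂ i)               ≡⟨ I₂.balanced q (trans (sym (∣⊥++q∣≡∣q∣ v₁ q)) ∣S∣≡t) i j ⟩
    countContaining q (T₂ j)               ≡⟨ countContaining-⊕ʳ ne-q (T₁ j) (T₂ j) ⟨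
    countContaining (⊥ ++ q) ((T₁ ⊕ᵗ T₂) j) ∎
    where open ≡-Reasoning
  ... | both ne-p ne-q = trans (countContaining-⊕-straddling ne-p ne-q (T₁ i) (T₂ i))
                          (sym (countContaining-⊕-straddling ne-p ne-q (T₁ j) (T₂ j)))

found-⊕ᵗ : (T₁ : Fin (suc μ) → Vec (Subset m) k) (T₂ : Fin (suc μ) → Vec (Subset n) l) →
  found (T₁ ⊕ᵗ T₂) ≡ found T₁ ++ found T₂
found-⊕ᵗ T₁ T₂ = cover-⊕ (T₁ Fin.zero) (T₂ Fin.zero)

-- Only for t ≥ 1: with t = 0 the Steiner condition says that the volume is at most 1, which is
-- not preserved by adding volumes.
⊕ᵗ-isSteiner : (T₁ : Fin (suc μ) → Vec (Subset v₁) m₁) (T₂ : Fin (suc μ) → Vec (Subset v₂) m₂) →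
  IsSteiner (suc t) T₁ → IsSteiner (suc t) T₂ → IsSteiner (suc t) (T₁ ⊕ᵗ T₂)
⊕ᵗ-isSteiner {v₁ = v₁} {v₂ = v₂} T₁ T₂ steiner₁ steiner₂ S ∣S∣≡1+t S⊆found i with subsetView {v₁} {v₂} S
... | empty = ⊥-elim (0≢1+n (trans (sym (∣⊥∣≡0 (v₁ + v₂))) ∣S∣≡1+t))
... | left {p} ne-p = subst (_≤ 1) (sym (countContaining-⊕ˡ ne-p (T₁ i) (T₂ i)))
  (steiner₁ p (trans (sym (∣p++⊥∣≡∣p∣ v₂ p)) ∣S∣≡1+t)
    (⊆-++⁻ˡ (subst ((p ++ ⊥) ⊆_) (found-⊕ᵗ T₁ T₂) S⊆found)) i)
... | right {q} ne-q = subst (_≤ 1) (sym (countContaining-⊕ʳ ne-q (T₁ i) (T₂ i)))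
  (steiner₂ q (trans (sym (∣⊥++q∣≡∣q∣ v₁ q)) ∣S∣≡1+t)
    (⊆-++⁻ʳ {a = ⊥} {found T₁} (subst ((⊥ {v₁} ++ q) ⊆_) (found-⊕ᵗ T₁ T₂) S⊆found)) i)
... | both ne-p ne-q = subst (_≤ 1) (sym (countContaining-⊕-straddling ne-p ne-q (T₁ i) (T₂ i))) z≤n

⊕ᵗ-isHomogeneous : (T₁ : Fin μ → Vec (Subset v₁) m₁) (T₂ : Fin μ → Vec (Subset v₂) m₂) →
  IsHomogeneous d T₁ → IsHomogeneous d T₂ → IsHomogeneous d (T₁ ⊕ᵗ T₂)
⊕ᵗ-isHomogeneous {v₁ = v₁} {v₂ = v₂} T₁ T₂ homogeneous₁ homogeneous₂ x i with finView v₁ v₂ x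
... | inl y = trans (cong (λ S → countContaining S ((T₁ ⊕ᵗ T₂) i)) (⁅↑ˡ⁆ y))
                (trans (countContaining-⊕ˡ (y , x∈⁅x⁆ y) (T₁ i) (T₂ i)) (homogeneous₁ y i))
... | inr y = trans (cong (λ S → countContaining S ((T₁ ⊕ᵗ T₂) i)) (⁅↑ʳ⁆ v₁ y))
                (trans (countContaining-⊕ʳ (y , x∈⁅x⁆ y) (T₁ i) (T₂ i)) (homogeneous₂ y i))

lemma1p6 : ∀ (d v₁ v₂ m₁ m₂ : ℕ) →
           SteinerTrade3 d v₁ m₁ → SteinerTrade3 d v₂ m₂ →
           SteinerTrade3 d (v₁ + v₂) (m₁ + m₂)
lemma1p6 d v₁ v₂ m₁ m₂ (T₁ , trade₁ , steiner₁ , homogeneous₁) (T₂ , trade₂ , steiner₂ , homogeneous₂) =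
  T₁ ⊕ᵗ T₂ ,
  ⊕ᵗ-isTrade trade₁ trade₂ ,
  ⊕ᵗ-isSteiner T₁ T₂ steiner₁ steiner₂ ,
  ⊕ᵗ-isHomogeneous T₁ T₂ homogeneous₁ homogeneous₂
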